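{- For $\rho\in\mathbb N$ and $\tau\in\mathbb N^*$, there is a bijection between $\mathcal F^\rho_\tau$ and $\mathcal D^{ -1}_{3,3\rho+\tau,\rho}$.
   Context: Let $\mathbb N=\{0,1,\dots\}$, $\mathbb N^*=\mathbb N\setminus\{0\}$ and $\mathcal F=\bigcup_{k\geq1}(\mathbb N^*)^k$ the set of finite nonempty words over $\mathbb N^*$; $|u|$ is the length of $u$, $uv$ concatenation; for $|w|\geq 2$ the parent $pa(w)$ is $w$ with its last letter removed, and $w$ is a child of $pa(w)$. A forest is a nonempty finite $F\subseteq\mathcal F$ such that: (1) there is $t(F)\in\mathbb N$ with $\{u\in F:|u|=1\}=\{1,\dots,t(F)+1\}$; (2) if $u\in F$ and $|u|\geq 2$ then $pa(u)\in F$; (3) for each $u\in F$ there is $c_u(F)\in\mathbb N$ with $ui\in F$ iff $i\leq c_u(F)$; (4) $c_{t(F)+1}(F)=0$. $\mathbb F^\rho_\tau$ is the set of forests with $t(F)=\tau$ and $\rho+\tau+1$ elements. A well-labeled forest is a pair $(F,\ell)$ with $F$ a forest and $\ell:F\to\mathbb Z$ such that $\ell(u)=0$ if $|u|=1$, $\ell(u)=-1$ if $|u|=2$, and for every $u$ with $|u|\geq2$ and $c_u(F)\geq1$: $\ell(u)-1\leq\ell(u1)\leq\ell(u2)\leq\dots\leq\ell(u\,c_u(F))\leq\ell(u)+1$. $\mathcal F^\rho_\tau$ is the set of well-labeled forests $(F,\ell)$ with $F\in\mathbb F^\rho_\tau$. For a binary word $b=b_1\cdots b_p\in\{0,1\}^p$,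 $|b|_x$ is the number of letters equal to $x$; $b$ is $3$-dominating if $|b_1\cdots b_i|_0>3|b_1\cdots b_i|_1$ for all $1\leq i\leq p$. $\mathcal D_{3,p,q}$ is the set of $3$-dominating words with $p$ zeros and $q$ ones, and $\mathcal D^{ -1}_{3,p,q}$ is the set of words whose reversal $b_p\cdots b_1$ lies in $\mathcal D_{3,p,q}$. -}

module Defs where

open import Data.Nat using (ℕ; zero; suc; _+_; _*_; _≤_; _<_)
open import Data.Integer as ℤ using (ℤ; +_; -[1+_])
open import Data.Bool using (Bool; true; false)
open import Data.List using (List; []; _∷_; _++_; [_]; length; map; take; reverse; filter)
open import Data.List.Membership.Propositional using (_∈_; _∉_)
open import Data.List.Relation.Unary.All using (All)
open import Data.List.Relation.Unary.Unique.Propositional using (Unique)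
open import Data.List.Relation.Binary.Permutation.Propositional using (_↭_; ↭-setoid)
open import Data.Product using (Σ; ∃; _×_; _,_; proj₁; proj₂)
open import Function.Bundles using (_⇔_)
open import Relation.Binary.Bundles using (Setoid)
open import Relation.Binary.PropositionalEquality using (_≡_; _≢_)
import Relation.Binary.PropositionalEquality as ≡
import Relation.Binary.Construct.On as On
open import Relation.Nullary using (¬_)

-- Words over ℕ* (represented as lists of naturals whose letters are ≥ 1)

Word : Set
Word = List ℕ

IsWord : Word → Set
IsWord u = (u ≢ []) × All (λ i → 1 ≤ i) u

pa : Word → Word
pa []           = []
pa (x ∷ [])     = []
pa (x ∷ y ∷ xs) = x ∷ pa (y ∷ xs)

-- Forests: a finite subset of 𝓕, given as a duplicate-free list D of words

record IsForest (D : List Word) (t : ℕ) : Set where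
  field
    unique   : Unique D
    words    : All IsWord D
    roots    : ∀ u → (u ∈ D × length u ≡ 1) ⇔ (∃ λ i → 1 ≤ i × i ≤ suc t × u ≡ [ i ])
    parent   : ∀ u → u ∈ D → 2 ≤ length u → pa u ∈ D
    children : ∀ u → u ∈ D → ∃ λ c → ∀ i → 1 ≤ i → (u ++ [ i ] ∈ D ⇔ i ≤ c)
    lastRoot : ∀ i → 1 ≤ i → (suc t ∷ [ i ]) ∉ D

-- Labelled forests: the graph of ℓ : F → ℤ as a list of pairs (u , ℓ u)

LForest : Set
LForest = List (Word × ℤ)

dom : LForest → List Word
dom = map proj₁

record IsWLF (ρ τ : ℕ) (L : LForest) : Set where
  field
    forest   : IsForest (dom L) τ          -- t(F) = τ; unique keys, so ℓ is a function on F
    size     : length L ≡ ρ + τ + 1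
    label1   : ∀ u z → (u , z) ∈ L → length u ≡ 1 → z ≡ + 0
    label2   : ∀ u z → (u , z) ∈ L → length u ≡ 2 → z ≡ -[1+ 0 ]
    -- for |u| ≥ 2 with c_u ≥ 1 :
    --   ℓ(u) - 1 ≤ ℓ(u1) ≤ ℓ(u2) ≤ … ≤ ℓ(u c_u) ≤ ℓ(u) + 1
    first    : ∀ u z z₁ → (u , z) ∈ L → 2 ≤ length u →
               (u ++ [ 1 ] , z₁) ∈ L → z ℤ.- ℤ.1ℤ ℤ.≤ z₁
    mono     : ∀ u i z₁ z₂ → 2 ≤ length u → 1 ≤ i →
               (u ++ [ i ] , z₁) ∈ L → (u ++ [ suc i ] , z₂) ∈ L → z₁ ℤ.≤ z₂
    last     : ∀ u i z zᵢ → (u , z) ∈ L → 2 ≤ length u → 1 ≤ i →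
               (u ++ [ i ] , zᵢ) ∈ L → (u ++ [ suc i ]) ∉ dom L → zᵢ ℤ.≤ z ℤ.+ ℤ.1ℤ

-- 𝓕^ρ_τ as a setoid: two representations are equal iff they list the same
-- pairs (u , ℓ u), i.e. they are permutations of each other.
WLF-setoid : ℕ → ℕ → Setoid _ _
WLF-setoid ρ τ = On.setoid {B = Σ LForest (IsWLF ρ τ)} ↭-setoid proj₁

-- Binary words: false = letter 0, true = letter 1

count0 count1 : List Bool → ℕ
count0 b = length (filter (λ x → x Data.Bool.≟ false) b)
  where import Data.Bool
count1 b = length (filter (λ x → x Data.Bool.≟ true) b)
  where import Data.Bool

Dominating3 : List Bool → Set
Dominating3 b = ∀ i → 1 ≤ i → i ≤ length b → 3 * count1 (take i b) < count0 (take i b)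

InD : ℕ → ℕ → List Bool → Set
InD p q b = Dominating3 b × count0 b ≡ p × count1 b ≡ q

InDInv : ℕ → ℕ → List Bool → Set
InDInv p q b = InD p q (reverse b)

DInv-setoid : ℕ → ℕ → Setoid _ _
DInv-setoid p q = On.setoid {B = Σ (List Bool) (InDInv p q)} (≡.setoid (List Bool)) proj₁

module Submission where

-- Both are put in bijection with lists of τ groves (lists of
-- trees) of ρ nodes in total, where each node lists its children in three groups:
-- labelled ℓ-1, ℓ, ℓ+1.  Since the labels of the children increase weakly within
-- [ℓ-1, ℓ+1], these are exactly the nodes of a well-labeled forest.
--
-- Words: a tree is coded as 1 followed by the codes of its groups, a grove as the
-- codes of its trees followed by 0.  A stack machine reading from the right
-- decodes; the suffix condition is exactly what prevents underflow.
--
-- Forests: groves are encoded as lists of (address , label) entries, described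
-- through the flattened labelled children ("kids") of each node.

open import Defs
open import Data.Bool using (Bool; true; false)
open import Data.Empty using (⊥; ⊥-elim)
open import Data.Integer as ℤ using (ℤ; +_; -[1+_])
import Data.Integer.Properties as ℤₚ
open import Data.List using (List; []; _∷_; _++_; [_]; length; map; take; reverse; filter; initLast; _∷ʳ′_)
import Data.List.Properties as Listₚ
open import Data.List.Membership.Propositional using (_∈_; _∉_)
open import Data.List.Membership.Propositional.Properties using (∈-++⁻; ∈-++⁺ˡ; ∈-++⁺ʳ; ∈-map⁻; ∈-map⁺)
open import Data.List.Relation.Unary.All as All using (All; []; _∷_)
import Data.List.Relation.Unary.All.Properties as Allₚ
import Data.List.Relation.Unary.AllPairs as AllPairs
open import Data.List.Relation.Unary.Unique.Propositional using (Unique)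
import Data.List.Relation.Unary.Unique.Propositional.Properties as Uniqueₚ
open import Data.List.Relation.Unary.Any using (here; there)
open import Data.List.Relation.Unary.Linked using (Linked; [-]; _∷_) renaming (tail to linked-tail)
import Data.List.Relation.Unary.Linked.Properties as Linkedₚ
open import Data.List.Relation.Binary.Permutation.Propositional using (_↭_; ↭-sym; ↭-trans; ↭-reflexive)
open import Data.List.Relation.Binary.BagAndSetEquality using (∼bag⇒↭)
open import Data.List.Membership.Propositional.Properties.WithK using (unique∧set⇒bag)
import Data.List.Relation.Binary.Permutation.Propositional.Properties as Permₚ
open import Data.List.Extrema.Nat using (max; ⊥≤max; xs≤max)
open import Data.Maybe using (Maybe; just; nothing)
import Data.Maybe.Properties as Maybeₚ
open import Data.Nat using (ℕ; zero; suc; _+_; _*_; _≤_; _<_; z≤n; s≤s)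
import Data.Nat.Properties as ℕₚ
open import Data.Nat.Tactic.RingSolver using (solve-∀)
open import Data.Product using (Σ; ∃; ∃₂; _×_; _,_; proj₁; proj₂)
open import Data.Sum using (_⊎_; inj₁; inj₂)
open import Function.Bundles using (Bijection; _⇔_; mk⇔; Equivalence)
open import Relation.Binary.PropositionalEquality
  using (_≡_; _≢_; refl; sym; trans; cong; cong₂; subst; subst₂; module ≡-Reasoning)
open import Relation.Nullary using (¬_; Dec; yes; no)

-- A node lists its children in three groups: those labelled one less than the
-- node, those labelled like the node, and those labelled one more.
data Tree : Set where
  node : (down level up : List Tree) → Tree

Grove : Set
Grove = List Tree

leaf : Tree
leaf = node [] [] []

mutual
  treeSize : Tree → ℕ
  treeSize (node b m a) = suc (groveSize b + groveSize m + groveSize a)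

  groveSize : Grove → ℕ
  groveSize []       = 0
  groveSize (t ∷ ts) = treeSize t + groveSize ts

grovesSize : List Grove → ℕ
grovesSize []       = 0
grovesSize (S ∷ X) = groveSize S + grovesSize X

mutual
  codeTree : Tree → List Bool
  codeTree (node b m a) = true ∷ codeGrove b ++ codeGrove m ++ codeGrove a

  codeGrove : Grove → List Bool
  codeGrove []       = [ false ]
  codeGrove (t ∷ ts) = codeTree t ++ codeGrove ts

codeGroves : List Grove → List Bool
codeGroves []      = []
codeGroves (S ∷ X) = codeGrove S ++ codeGroves X

codeGroves-node : ∀ b m a S X →
  codeGroves ((node b m a ∷ S) ∷ X) ≡ true ∷ codeGroves (b ∷ m ∷ a ∷ S ∷ X)
codeGroves-node b m a S X = cong (true ∷_) (begin
    ((codeGrove b ++ codeGrove m ++ codeGrove a) ++ codeGrove S) ++ codeGroves X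
  ≡⟨ Listₚ.++-assoc (codeGrove b ++ codeGrove m ++ codeGrove a) _ _ ⟩
    (codeGrove b ++ codeGrove m ++ codeGrove a) ++ codeGrove S ++ codeGroves X
  ≡⟨ Listₚ.++-assoc (codeGrove b) (codeGrove m ++ codeGrove a) _ ⟩
    codeGrove b ++ (codeGrove m ++ codeGrove a) ++ codeGrove S ++ codeGroves X
  ≡⟨ cong (codeGrove b ++_) (Listₚ.++-assoc (codeGrove m) (codeGrove a) _) ⟩
    codeGrove b ++ codeGrove m ++ codeGrove a ++ codeGrove S ++ codeGroves X ∎)
  where open ≡-Reasoning

-- Reading one letter (the word is read from right to left): 0 opens a new
-- empty grove, 1 turns the three topmost groves into a node and puts it in
-- front of the fourth.  Underflow never happens on codes (see decode-code).
push : List Grove → Bool → List Grove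
push X                     false = [] ∷ X
push (b ∷ m ∷ a ∷ S ∷ X) true  = (node b m a ∷ S) ∷ X
push _                     true  = []

decode : List Bool → List Grove
decode []      = []
decode (x ∷ w) = push (decode w) x

pop : ∀ X x w → codeGroves X ≡ x ∷ w → ∃ λ Y → codeGroves Y ≡ w × push Y x ≡ X
pop []                       _ _ ()
pop ([] ∷ X)                 _ _ refl = X , refl , refl
pop ((node b m a ∷ S) ∷ X) x w eq with trans (sym (codeGroves-node b m a S X)) eq
... | refl = (b ∷ m ∷ a ∷ S ∷ X) , refl , refl

decode-code : ∀ w X → codeGroves X ≡ w → decode w ≡ X
decode-code []      []      _  = refl
decode-code []      ([] ∷ X) ()
decode-code []      ((node b m a ∷ S) ∷ X) eq with trans (sym (codeGroves-node b m a S X)) eq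
... | ()
decode-code (x ∷ w) X       eq with pop X x w eq
... | Y , codeY , pushY = trans (cong (λ Z → push Z x) (decode-code w Y codeY)) pushY

codeGroves-injective : ∀ X Y → codeGroves X ≡ codeGroves Y → X ≡ Y
codeGroves-injective X Y eq =
  trans (sym (decode-code (codeGroves X) X refl)) (decode-code (codeGroves X) Y (sym eq))

module _ {A : Set} {P : A → Set} (P? : ∀ x → Dec (P x)) where

  count-++ : ∀ xs ys →
    length (filter P? (xs ++ ys)) ≡ length (filter P? xs) + length (filter P? ys)
  count-++ xs ys = trans (cong length (Listₚ.filter-++ P? xs ys)) (Listₚ.length-++ (filter P? xs))

  count-reverse : ∀ xs → length (filter P? (reverse xs)) ≡ length (filter P? xs)
  count-reverse xs = Permₚ.↭-length (Permₚ.filter-↭ P? (Permₚ.↭-reverse xs))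

-- A tree of size n has n ones (one per node) and 3n zeros (one closing each group).
mutual
  ones-codeTree : ∀ t → count1 (codeTree t) ≡ treeSize t
  ones-codeTree (node b m a) = cong suc (begin
      count1 (codeGrove b ++ codeGrove m ++ codeGrove a)
    ≡⟨ count-++ _ (codeGrove b) _ ⟩
      count1 (codeGrove b) + count1 (codeGrove m ++ codeGrove a)
    ≡⟨ cong₂ _+_ (ones-codeGrove b) (trans (count-++ _ (codeGrove m) _)
                                           (cong₂ _+_ (ones-codeGrove m) (ones-codeGrove a))) ⟩
      groveSize b + (groveSize m + groveSize a)
    ≡⟨ sym (ℕₚ.+-assoc (groveSize b) _ _) ⟩
      groveSize b + groveSize m + groveSize a ∎)
    where open ≡-Reasoning

  ones-codeGrove : ∀ S → count1 (codeGrove S) ≡ groveSize S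
  ones-codeGrove []       = refl
  ones-codeGrove (t ∷ ts) = trans (count-++ _ (codeTree t) _) (cong₂ _+_ (ones-codeTree t) (ones-codeGrove ts))

mutual
  zeros-codeTree : ∀ t → count0 (codeTree t) ≡ 3 * treeSize t
  zeros-codeTree (node b m a) = begin
      count0 (codeGrove b ++ codeGrove m ++ codeGrove a)
    ≡⟨ count-++ _ (codeGrove b) _ ⟩
      count0 (codeGrove b) + count0 (codeGrove m ++ codeGrove a)
    ≡⟨ cong₂ _+_ (zeros-codeGrove b) (trans (count-++ _ (codeGrove m) _)
                                            (cong₂ _+_ (zeros-codeGrove m) (zeros-codeGrove a))) ⟩
      (3 * groveSize b + 1) + ((3 * groveSize m + 1) + (3 * groveSize a + 1))
    ≡⟨ arith (groveSize b) (groveSize m) (groveSize a) ⟩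
      3 * suc (groveSize b + groveSize m + groveSize a) ∎
    where
      open ≡-Reasoning
      arith : ∀ x y z → (3 * x + 1) + ((3 * y + 1) + (3 * z + 1)) ≡ 3 * suc (x + y + z)
      arith = solve-∀

  zeros-codeGrove : ∀ S → count0 (codeGrove S) ≡ 3 * groveSize S + 1
  zeros-codeGrove []       = refl
  zeros-codeGrove (t ∷ ts) =
    trans (count-++ _ (codeTree t) _)
          (trans (cong₂ _+_ (zeros-codeTree t) (zeros-codeGrove ts)) (arith (treeSize t) (groveSize ts)))
    where
      arith : ∀ x y → 3 * x + (3 * y + 1) ≡ 3 * (x + y) + 1
      arith = solve-∀

ones-codeGroves : ∀ X → count1 (codeGroves X) ≡ grovesSize X
ones-codeGroves []      = refl
ones-codeGroves (S ∷ X) = trans (count-++ _ (codeGrove S) _) (cong₂ _+_ (ones-codeGrove S) (ones-codeGroves X))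

zeros-codeGroves : ∀ X → count0 (codeGroves X) ≡ 3 * grovesSize X + length X
zeros-codeGroves []      = refl
zeros-codeGroves (S ∷ X) =
  trans (count-++ _ (codeGrove S) _)
        (trans (cong₂ _+_ (zeros-codeGrove S) (zeros-codeGroves X))
               (arith (groveSize S) (grovesSize X) (length X)))
  where
    arith : ∀ x y n → (3 * x + 1) + (3 * y + n) ≡ 3 * (x + y) + suc n
    arith = solve-∀

Balanced : List Bool → Set
Balanced w = 3 * count1 w < count0 w

CoDominating : List Bool → Set
CoDominating w = Dominating3 (reverse w)

balanced-reverse : ∀ w → Balanced w → Balanced (reverse w)
balanced-reverse w = subst₂ (λ o z → 3 * o < z) (sym (count-reverse _ w)) (sym (count-reverse _ w))

balanced-unreverse : ∀ w → Balanced (reverse w) → Balanced w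
balanced-unreverse w = subst₂ (λ o z → 3 * o < z) (count-reverse _ w) (count-reverse _ w)

take-++ˡ : ∀ {A : Set} i (xs ys : List A) → i ≤ length xs → take i (xs ++ ys) ≡ take i xs
take-++ˡ zero    xs       ys _         = refl
take-++ˡ (suc i) (x ∷ xs) ys (s≤s i≤n) = cong (x ∷_) (take-++ˡ i xs ys i≤n)

dominating-∷ʳ : ∀ r x → Dominating3 (r ++ [ x ]) ⇔ (Dominating3 r × Balanced (r ++ [ x ]))
dominating-∷ʳ r x = mk⇔
  (λ D → (λ i 1≤i i≤r → subst Balanced (take-++ˡ i r [ x ] i≤r) (D i 1≤i (ℕₚ.≤-trans i≤r r≤rx)))
       , subst Balanced (Listₚ.take-all _ (r ++ [ x ]) ℕₚ.≤-refl) (D _ 1≤rx ℕₚ.≤-refl))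
  λ { (D , B) i 1≤i i≤rx → prefix D B i 1≤i i≤rx }
  where
    rx≡1+r : length (r ++ [ x ]) ≡ suc (length r)
    rx≡1+r = trans (Listₚ.length-++ r) (ℕₚ.+-comm (length r) 1)
    r≤rx : length r ≤ length (r ++ [ x ])
    r≤rx = subst (length r ≤_) (sym rx≡1+r) (ℕₚ.n≤1+n _)
    1≤rx : 1 ≤ length (r ++ [ x ])
    1≤rx = subst (1 ≤_) (sym rx≡1+r) (s≤s z≤n)
    prefix : Dominating3 r → Balanced (r ++ [ x ]) → Dominating3 (r ++ [ x ])
    prefix D B i 1≤i i≤rx with i ℕₚ.≤? length r
    ... | yes i≤r = subst Balanced (sym (take-++ˡ i r [ x ] i≤r)) (D i 1≤i i≤r)
    ... | no  i≰r = subst Balanced (sym (Listₚ.take-all i (r ++ [ x ]) rx≤i)) B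
      where rx≤i = subst (_≤ i) (sym rx≡1+r) (ℕₚ.≰⇒> i≰r)

coDominating-∷ : ∀ x w → CoDominating (x ∷ w) ⇔ (CoDominating w × Balanced (x ∷ w))
coDominating-∷ x w = mk⇔
  (λ D → let (Dw , B) = Equivalence.to (dominating-∷ʳ (reverse w) x) (subst Dominating3 rev D)
         in Dw , balanced-unreverse (x ∷ w) (subst Balanced (sym rev) B))
  λ { (Dw , B) → subst Dominating3 (sym rev) (Equivalence.from (dominating-∷ʳ (reverse w) x)
                   (Dw , subst Balanced rev (balanced-reverse (x ∷ w) B))) }
  where rev = Listₚ.unfold-reverse x w


-- A nonempty list of groves has 3·size + length > 3·size zeros against size ones.
codeGroves-balanced : ∀ S X → Balanced (codeGroves (S ∷ X))
codeGroves-balanced S X =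
  subst₂ (λ o z → 3 * o < z) (sym (ones-codeGroves (S ∷ X))) (sym (zeros-codeGroves (S ∷ X)))
         (ℕₚ.m<m+n (3 * grovesSize (S ∷ X)) (s≤s z≤n))

-- Every code is suffix-dominated: its nonempty suffixes are codes of nonempty lists of groves.
codeGroves-coDominating : ∀ w X → codeGroves X ≡ w → CoDominating w
codeGroves-coDominating []      _        _  _ (s≤s _) ()
codeGroves-coDominating (x ∷ w) []       ()
codeGroves-coDominating (x ∷ w) (S ∷ X) eq with pop (S ∷ X) x w eq
... | Y , codeY , _ = Equivalence.from (coDominating-∷ x w)
  (codeGroves-coDominating w Y codeY , subst Balanced eq (codeGroves-balanced S X))

deep-stack : ∀ X → Balanced (true ∷ codeGroves X) → 4 ≤ length X
deep-stack X B = ℕₚ.+-cancelʳ-≤ (3 * s) 4 (length X)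
  (subst₂ _≤_ (arith s) (ℕₚ.+-comm (3 * s) (length X))
    (subst₂ (λ o z → 3 * suc o < z) (ones-codeGroves X) (zeros-codeGroves X) B))
  where
    s = grovesSize X
    arith : ∀ n → suc (3 * suc n) ≡ 4 + 3 * n
    arith = solve-∀

push-true : ∀ X → 4 ≤ length X → codeGroves (push X true) ≡ true ∷ codeGroves X
push-true (b ∷ m ∷ a ∷ S ∷ X) _ = codeGroves-node b m a S X
push-true []               ()
push-true (_ ∷ [])         (s≤s ())
push-true (_ ∷ _ ∷ [])     (s≤s (s≤s ()))
push-true (_ ∷ _ ∷ _ ∷ []) (s≤s (s≤s (s≤s ())))

decode-correct : ∀ w → CoDominating w → codeGroves (decode w) ≡ w
decode-correct []          _ = refl
decode-correct (false ∷ w) D =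
  cong (false ∷_) (decode-correct w (proj₁ (Equivalence.to (coDominating-∷ false w) D)))
decode-correct (true ∷ w)  D = begin
    codeGroves (push (decode w) true) ≡⟨ push-true (decode w) (deep-stack (decode w) balanced) ⟩
    true ∷ codeGroves (decode w)      ≡⟨ cong (true ∷_) ih ⟩
    true ∷ w                          ∎
  where
    open ≡-Reasoning
    peeled = Equivalence.to (coDominating-∷ true w) D
    ih = decode-correct w (proj₁ peeled)
    balanced : Balanced (true ∷ codeGroves (decode w))
    balanced = subst (λ v → Balanced (true ∷ v)) (sym ih) (proj₂ peeled)

codeGroves-inDInv : ∀ X → InDInv (3 * grovesSize X + length X) (grovesSize X) (codeGroves X)
codeGroves-inDInv X = codeGroves-coDominating _ X refl
                    , trans (count-reverse _ (codeGroves X)) (zeros-codeGroves X)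
                    , trans (count-reverse _ (codeGroves X)) (ones-codeGroves X)

-- At k xs i x: when the entries of xs are numbered from k on, entry i is x.
data At {A : Set} : ℕ → List A → ℕ → A → Set where
  now  : ∀ {k x xs} → At k (x ∷ xs) k x
  next : ∀ {k y xs i x} → At (suc k) xs i x → At k (y ∷ xs) i x

module _ {A : Set} where

  at-range : ∀ {k xs i} {x : A} → At k xs i x → k ≤ i × i < k + length xs
  at-range {k} {_ ∷ xs} now = ℕₚ.≤-refl , ℕₚ.m<m+n k (s≤s z≤n)
  at-range {k} {_ ∷ xs} {i} (next at) with at-range at
  ... | k<i , i< = ℕₚ.<⇒≤ k<i , subst (i <_) (sym (ℕₚ.+-suc k (length xs))) i<

  at-not-before : ∀ {k xs i} {x : A} → At k xs i x → i < k → ⊥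
  at-not-before at i<k = ℕₚ.<-irrefl refl (ℕₚ.<-≤-trans i<k (proj₁ (at-range at)))

  at-functional : ∀ {k xs i} {x y : A} → At k xs i x → At k xs i y → x ≡ y
  at-functional now       now       = refl
  at-functional now       (next at) = ⊥-elim (at-not-before at (ℕₚ.n<1+n _))
  at-functional (next at) now       = ⊥-elim (at-not-before at (ℕₚ.n<1+n _))
  at-functional (next at) (next bt) = at-functional at bt

  at-exists : ∀ k (xs : List A) i → k ≤ i → i < k + length xs → ∃ (At k xs i)
  at-exists k []       i k≤i i< = ⊥-elim (ℕₚ.<-irrefl refl (ℕₚ.≤-<-trans k≤i (subst (i <_) (ℕₚ.+-identityʳ k) i<)))
  at-exists k (x ∷ xs) i k≤i i< with ℕₚ.m≤n⇒m<n∨m≡n k≤i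
  ... | inj₂ refl = x , now
  ... | inj₁ k<i  = let (y , at) = at-exists (suc k) xs i k<i (subst (i <_) (ℕₚ.+-suc k (length xs)) i<)
                    in y , next at

  at-∈ : ∀ {k xs i} {x : A} → At k xs i x → x ∈ xs
  at-∈ now       = here refl
  at-∈ (next at) = there (at-∈ at)

  ∈-at : ∀ k {xs} {x : A} → x ∈ xs → ∃ λ i → At k xs i x
  ∈-at k (here refl) = k , now
  ∈-at k (there mem) = let (i , at) = ∈-at (suc k) mem in i , next at

module _ {A B : Set} {R : B → B → Set} (f : A → B) where

  chain-first : ∀ {lo k xs ys x} → Linked R (lo ∷ map f xs ++ ys) → At k xs k x → R lo (f x)
  chain-first {xs = _ ∷ _} (r ∷ _) now = r
  chain-first _       (next at) = ⊥-elim (at-not-before at (ℕₚ.n<1+n _))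

  chain-step : ∀ {k xs ys i x y} → Linked R (map f xs ++ ys) → At k xs i x → At k xs (suc i) y → R (f x) (f y)
  chain-step {xs = _ ∷ _ ∷ _} (r ∷ _) now (next now) = r
  chain-step _       now       (next (next at)) = ⊥-elim (at-not-before at (ℕₚ.n<1+n _))
  chain-step _       (next at) now              = ⊥-elim (at-not-before at (ℕₚ.<-trans (ℕₚ.n<1+n _) (ℕₚ.n<1+n _)))
  chain-step {xs = _ ∷ _ ∷ _} (_ ∷ c) (next at) (next bt) = chain-step c at bt

  chain-last : ∀ {k xs hi i x} → Linked R (map f xs ++ [ hi ]) → At k xs i x →
               (∀ y → ¬ At k xs (suc i) y) → R (f x) hi
  chain-last {xs = _ ∷ []}    (r ∷ _) now       _      = r
  chain-last {xs = _ ∷ _ ∷ _} _       now       no-suc = ⊥-elim (no-suc _ (next now))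
  chain-last {xs = _ ∷ _ ∷ _} (_ ∷ c) (next at) no-suc = chain-last c at (λ y at′ → no-suc y (next at′))

dom-∈ : ∀ {E : LForest} {v} → v ∈ dom E → ∃ λ z → (v , z) ∈ E
dom-∈ {E} v∈ with ∈-map⁻ proj₁ v∈
... | (_ , z) , mem , refl = z , mem

∈-dom : ∀ {E : LForest} {v z} → (v , z) ∈ E → v ∈ dom E
∈-dom = ∈-map⁺ proj₁

below≢ : ∀ (a : Word) j w → a ++ j ∷ w ≢ a
below≢ a j w eq with Listₚ.++-identityʳ-unique a (sym eq)
... | ()

below-injective : ∀ (a : Word) {j j′ w w′} → a ++ j ∷ w ≡ a ++ j′ ∷ w′ → j ≡ j′ × w ≡ w′
below-injective a eq = Listₚ.∷-injective (Listₚ.++-cancelˡ a _ _ eq)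

length-∷ʳ : ∀ (a : Word) j → length (a ++ [ j ]) ≡ suc (length a)
length-∷ʳ a j = trans (Listₚ.length-++ a) (ℕₚ.+-comm (length a) 1)

pa-∷ʳ : ∀ (a : Word) j → pa (a ++ [ j ]) ≡ a
pa-∷ʳ []          j = refl
pa-∷ʳ (x ∷ [])    j = refl
pa-∷ʳ (x ∷ y ∷ a) j = cong (x ∷_) (pa-∷ʳ (y ∷ a) j)

below above : ℤ → ℤ
below l = l ℤ.- ℤ.1ℤ
above l = l ℤ.+ ℤ.1ℤ

below≡pred : ∀ l → below l ≡ ℤ.pred l
below≡pred l = ℤₚ.+-comm l ℤ.-1ℤ

above≡suc : ∀ l → above l ≡ ℤ.suc l
above≡suc l = ℤₚ.+-comm l ℤ.1ℤ

below<self : ∀ l → below l ℤ.< l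
below<self l = ℤₚ.i≤pred[j]⇒i<j (ℤₚ.≤-reflexive (below≡pred l))

self<above : ∀ l → l ℤ.< above l
self<above l = ℤₚ.suc[i]≤j⇒i<j (ℤₚ.≤-reflexive (sym (above≡suc l)))

below≤above : ∀ l → below l ℤ.≤ above l
below≤above l = ℤₚ.<⇒≤ (ℤₚ.<-trans (below<self l) (self<above l))

three-values : ∀ {l z} → below l ℤ.≤ z → z ℤ.≤ above l → z ≡ below l ⊎ z ≡ l ⊎ z ≡ above l
three-values {l} {z} lo hi with z ℤ.≟ below l | z ℤ.≟ l
... | yes z≡ | _     = inj₁ z≡
... | no _   | yes z≡ = inj₂ (inj₁ z≡)
... | no z≢₁ | no z≢₂ = inj₂ (inj₂ (ℤₚ.≤-antisym hi above≤z))
  where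
    l≤z : l ℤ.≤ z
    l≤z = subst (ℤ._≤ z) (trans (cong ℤ.suc (below≡pred l)) (ℤₚ.suc-pred l))
                (ℤₚ.i<j⇒suc[i]≤j (ℤₚ.≤∧≢⇒< lo (λ e → z≢₁ (sym e))))
    above≤z : above l ℤ.≤ z
    above≤z = subst (ℤ._≤ z) (sym (above≡suc l))
                    (ℤₚ.i<j⇒suc[i]≤j (ℤₚ.≤∧≢⇒< l≤z (λ e → z≢₂ (sym e))))

Kids : Set
Kids = List (ℤ × Tree)

labels : Kids → List ℤ
labels = map proj₁

kids : ℤ → Tree → Kids
kids l (node b m a) = map (below l ,_) b ++ map (l ,_) m ++ map (above l ,_) a

LabelChain : ℤ → Kids → Set
LabelChain l zts = Linked ℤ._≤_ (below l ∷ labels zts ++ [ above l ])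

lower-head : ∀ {x y ys} → x ℤ.≤ y → Linked ℤ._≤_ (y ∷ ys) → Linked ℤ._≤_ (x ∷ ys)
lower-head x≤y [-]         = [-]
lower-head x≤y (y≤z ∷ ys) = ℤₚ.≤-trans x≤y y≤z ∷ ys

chain-block : ∀ {x ys} ts → Linked ℤ._≤_ (x ∷ ys) → Linked ℤ._≤_ (x ∷ labels (map (x ,_) ts) ++ ys)
chain-block []       c = c
chain-block (t ∷ ts) c = ℤₚ.≤-refl ∷ chain-block ts c

kids-chain : ∀ l t → LabelChain l (kids l t)
kids-chain l (node b m a) = subst (λ zs → Linked ℤ._≤_ (below l ∷ zs)) (sym flatten)
  (chain-block b (lower-head (ℤₚ.<⇒≤ (below<self l))
    (chain-block m (lower-head (ℤₚ.<⇒≤ (self<above l))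
      (chain-block a (ℤₚ.≤-refl ∷ [-]))))))
  where
    B = map (below l ,_) b
    M = map (l ,_) m
    A = map (above l ,_) a
    flatten : labels (B ++ M ++ A) ++ [ above l ] ≡ labels B ++ labels M ++ labels A ++ [ above l ]
    flatten = begin
        labels (B ++ M ++ A) ++ [ above l ]
      ≡⟨ cong (_++ [ above l ]) (trans (Listₚ.map-++ proj₁ B (M ++ A))
                                      (cong (labels B ++_) (Listₚ.map-++ proj₁ M A))) ⟩
        (labels B ++ labels M ++ labels A) ++ [ above l ]
      ≡⟨ Listₚ.++-assoc (labels B) (labels M ++ labels A) _ ⟩
        labels B ++ (labels M ++ labels A) ++ [ above l ]
      ≡⟨ cong (labels B ++_) (Listₚ.++-assoc (labels M) (labels A) _) ⟩
        labels B ++ labels M ++ labels A ++ [ above l ] ∎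
      where open ≡-Reasoning

addKid : ℤ → ℤ × Tree → Tree → Tree
addKid l (z , t) (node b m a) with z ℤ.≟ below l | z ℤ.≟ l
... | yes _ | _     = node (t ∷ b) m a
... | no _  | yes _ = node b (t ∷ m) a
... | no _  | no _  = node b m (t ∷ a)

regroup : ℤ → Kids → Tree
regroup l []         = leaf
regroup l (zt ∷ zts) = addKid l zt (regroup l zts)

addKid-below : ∀ l t b m a → addKid l (below l , t) (node b m a) ≡ node (t ∷ b) m a
addKid-below l t b m a with below l ℤ.≟ below l | below l ℤ.≟ l
... | yes _  | _ = refl
... | no ne | _ = ⊥-elim (ne refl)

addKid-level : ∀ l t b m a → addKid l (l , t) (node b m a) ≡ node b (t ∷ m) a
addKid-level l t b m a with l ℤ.≟ below l | l ℤ.≟ l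
... | yes eq | _     = ⊥-elim (ℤₚ.<-irrefl (sym eq) (below<self l))
... | no _   | yes _ = refl
... | no _   | no ne = ⊥-elim (ne refl)

addKid-above : ∀ l t b m a → addKid l (above l , t) (node b m a) ≡ node b m (t ∷ a)
addKid-above l t b m a with above l ℤ.≟ below l | above l ℤ.≟ l
... | yes eq | _      = ⊥-elim (ℤₚ.<-irrefl (sym eq) (ℤₚ.<-trans (below<self l) (self<above l)))
... | no _   | yes eq = ⊥-elim (ℤₚ.<-irrefl (sym eq) (self<above l))
... | no _   | no _   = refl

regroup-aboves : ∀ l a → regroup l (map (above l ,_) a) ≡ node [] [] a
regroup-aboves l []      = refl
regroup-aboves l (t ∷ a) rewrite regroup-aboves l a = addKid-above l t [] [] a

regroup-levels : ∀ l m a → regroup l (map (l ,_) m ++ map (above l ,_) a) ≡ node [] m a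
regroup-levels l []      a = regroup-aboves l a
regroup-levels l (t ∷ m) a rewrite regroup-levels l m a = addKid-level l t [] m a

regroup-kids : ∀ l t → regroup l (kids l t) ≡ t
regroup-kids l (node []      m a) = regroup-levels l m a
regroup-kids l (node (t ∷ b) m a) rewrite regroup-kids l (node b m a) = addKid-below l t b m a

regroup-belows : ∀ l zts → All (λ zt → proj₁ zt ≡ below l) zts → regroup l zts ≡ node (map proj₂ zts) [] []
regroup-belows l []              []           = refl
regroup-belows l ((_ , t) ∷ zts) (refl ∷ zs) rewrite regroup-belows l zts zs =
  addKid-below l t (map proj₂ zts) [] []

kids-addKid : ∀ l z t T → z ≡ below l ⊎ z ≡ l ⊎ z ≡ above l → All (z ℤ.≤_) (labels (kids l T)) →
              kids l (addKid l (z , t) T) ≡ (z , t) ∷ kids l T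
kids-addKid l _ t (node b m a)         (inj₁ refl)        _ rewrite addKid-below l t b m a = refl
kids-addKid l _ t (node [] m a)        (inj₂ (inj₁ refl)) _ rewrite addKid-level l t [] m a = refl
kids-addKid l _ t (node (_ ∷ _) m a)   (inj₂ (inj₁ refl)) (l≤ ∷ _) =
  ⊥-elim (ℤₚ.<⇒≱ (below<self l) l≤)
kids-addKid l _ t (node [] [] a)       (inj₂ (inj₂ refl)) _ rewrite addKid-above l t [] [] a = refl
kids-addKid l _ t (node (_ ∷ _) m a)   (inj₂ (inj₂ refl)) (z≤ ∷ _) =
  ⊥-elim (ℤₚ.<⇒≱ (ℤₚ.<-trans (below<self l) (self<above l)) z≤)
kids-addKid l _ t (node [] (_ ∷ _) a)  (inj₂ (inj₂ refl)) (z≤ ∷ _) =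
  ⊥-elim (ℤₚ.<⇒≱ (self<above l) z≤)

kids-regroup-from : ∀ l lo zts → below l ℤ.≤ lo → Linked ℤ._≤_ (lo ∷ labels zts ++ [ above l ]) →
                    kids l (regroup l zts) ≡ zts
kids-regroup-from l lo []              _   _               = refl
kids-regroup-from l lo ((z , t) ∷ zts) lo≥ (lo≤z ∷ chain) = begin
    kids l (addKid l (z , t) (regroup l zts))
  ≡⟨ kids-addKid l z t (regroup l zts) (three-values below≤z z≤above)
                 (subst (λ zs → All (z ℤ.≤_) (labels zs)) (sym ih) z≤rest) ⟩
    (z , t) ∷ kids l (regroup l zts)
  ≡⟨ cong ((z , t) ∷_) ih ⟩
    (z , t) ∷ zts ∎
  where
    open ≡-Reasoning
    below≤z = ℤₚ.≤-trans lo≥ lo≤z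
    ih = kids-regroup-from l z zts below≤z chain
    z≤later : All (z ℤ.≤_) (labels zts ++ [ above l ])
    z≤later = All.tail (Linkedₚ.Linked⇒All ℤₚ.≤-trans ℤₚ.≤-refl chain)
    z≤rest = Allₚ.++⁻ˡ (labels zts) z≤later
    z≤above = All.head (Allₚ.++⁻ʳ (labels zts) z≤later)

kids-regroup : ∀ l zts → LabelChain l zts → kids l (regroup l zts) ≡ zts
kids-regroup l zts = kids-regroup-from l (below l) zts ℤₚ.≤-refl

mutual
  encTree : Word → ℤ → Tree → LForest
  encTree a l (node b m c) =
    (a , l) ∷ (encGrove a 1 (below l) b ++ encGrove a (suc (length b)) l m
               ++ encGrove a (suc (length b + length m)) (above l) c)

  encGrove : Word → ℕ → ℤ → Grove → LForest
  encGrove a k z []       = []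
  encGrove a k z (t ∷ ts) = encTree (a ++ [ k ]) z t ++ encGrove a (suc k) z ts

encKids : Word → ℕ → Kids → LForest
encKids a k []              = []
encKids a k ((z , t) ∷ zts) = encTree (a ++ [ k ]) z t ++ encKids a (suc k) zts

encGrove-kids : ∀ a k z ts → encGrove a k z ts ≡ encKids a k (map (z ,_) ts)
encGrove-kids a k z []       = refl
encGrove-kids a k z (t ∷ ts) = cong (encTree (a ++ [ k ]) z t ++_) (encGrove-kids a (suc k) z ts)

encKids-++ : ∀ a k xs ys → encKids a k (xs ++ ys) ≡ encKids a k xs ++ encKids a (k + length xs) ys
encKids-++ a k []       ys = cong (λ n → encKids a n ys) (sym (ℕₚ.+-identityʳ k))
encKids-++ a k ((z , t) ∷ xs) ys = begin
    encTree (a ++ [ k ]) z t ++ encKids a (suc k) (xs ++ ys)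
  ≡⟨ cong (encTree (a ++ [ k ]) z t ++_) (encKids-++ a (suc k) xs ys) ⟩
    encTree (a ++ [ k ]) z t ++ encKids a (suc k) xs ++ encKids a (suc k + length xs) ys
  ≡⟨ sym (Listₚ.++-assoc (encTree (a ++ [ k ]) z t) _ _) ⟩
    encKids a k ((z , t) ∷ xs) ++ encKids a (suc k + length xs) ys
  ≡⟨ cong (λ n → encKids a k ((z , t) ∷ xs) ++ encKids a n ys) (sym (ℕₚ.+-suc k (length xs))) ⟩
    encKids a k ((z , t) ∷ xs) ++ encKids a (k + length ((z , t) ∷ xs)) ys ∎
  where open ≡-Reasoning

encTree-kids : ∀ a l t → encTree a l t ≡ (a , l) ∷ encKids a 1 (kids l t)
encTree-kids a l (node b m c) = cong ((a , l) ∷_) (sym (begin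
    encKids a 1 (B ++ M ++ C)
  ≡⟨ encKids-++ a 1 B (M ++ C) ⟩
    encKids a 1 B ++ encKids a (suc (length B)) (M ++ C)
  ≡⟨ cong (encKids a 1 B ++_) (encKids-++ a (suc (length B)) M C) ⟩
    encKids a 1 B ++ encKids a (suc (length B)) M ++ encKids a (suc (length B + length M)) C
  ≡⟨ cong₂ (λ nb nm → encKids a 1 B ++ encKids a (suc nb) M ++ encKids a (suc (nb + nm)) C)
           (Listₚ.length-map _ b) (Listₚ.length-map _ m) ⟩
    encKids a 1 B ++ encKids a (suc (length b)) M ++ encKids a (suc (length b + length m)) C
  ≡⟨ sym (cong₂ _++_ (encGrove-kids a 1 _ b) (cong₂ _++_ (encGrove-kids a _ l m) (encGrove-kids a _ _ c))) ⟩
    encGrove a 1 (below l) b ++ encGrove a (suc (length b)) l m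
      ++ encGrove a (suc (length b + length m)) (above l) c ∎))
  where
    open ≡-Reasoning
    B = map (below l ,_) b
    M = map (l ,_) m
    C = map (above l ,_) c

mutual
  encTree-length : ∀ a l t → length (encTree a l t) ≡ treeSize t
  encTree-length a l (node b m c) = cong suc (begin
      length (encGrove a 1 _ b ++ encGrove a _ l m ++ encGrove a _ _ c)
    ≡⟨ Listₚ.length-++ (encGrove a 1 _ b) ⟩
      length (encGrove a 1 _ b) + length (encGrove a _ l m ++ encGrove a _ _ c)
    ≡⟨ cong₂ _+_ (encGrove-length a 1 _ b)
                 (trans (Listₚ.length-++ (encGrove a _ l m))
                        (cong₂ _+_ (encGrove-length a _ l m) (encGrove-length a _ _ c))) ⟩
      groveSize b + (groveSize m + groveSize c)
    ≡⟨ sym (ℕₚ.+-assoc (groveSize b) _ _) ⟩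
      groveSize b + groveSize m + groveSize c ∎)
    where open ≡-Reasoning

  encGrove-length : ∀ a k z ts → length (encGrove a k z ts) ≡ groveSize ts
  encGrove-length a k z []       = refl
  encGrove-length a k z (t ∷ ts) = trans (Listₚ.length-++ (encTree (a ++ [ k ]) z t))
    (cong₂ _+_ (encTree-length (a ++ [ k ]) z t) (encGrove-length a (suc k) z ts))

module _ (P : Tree → Set) (step : ∀ t → (∀ {l z u} → (z , u) ∈ kids l t → P u) → P t) where

  private
    kid-tree : ∀ {w : ℤ} {ts : Grove} {z : ℤ} {u : Tree} → (z , u) ∈ map (w ,_) ts → u ∈ ts
    kid-tree {w} mem with ∈-map⁻ (w ,_) mem
    ... | _ , u∈ts , refl = u∈ts

  mutual
    tree-ind : ∀ t → P t
    tree-ind (node b m c) = step (node b m c) λ {l} mem → kid-ind l b m c mem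

    grove-ind : ∀ ts → All P ts
    grove-ind []       = []
    grove-ind (t ∷ ts) = tree-ind t ∷ grove-ind ts

    kid-ind : ∀ l b m c {z u} → (z , u) ∈ kids l (node b m c) → P u
    kid-ind l b m c mem with ∈-++⁻ (map (below l ,_) b) mem
    ... | inj₁ inB = All.lookup (grove-ind b) (kid-tree inB)
    ... | inj₂ mem′ with ∈-++⁻ (map (l ,_) m) mem′
    ...   | inj₁ inM = All.lookup (grove-ind m) (kid-tree inM)
    ...   | inj₂ inC = All.lookup (grove-ind c) (kid-tree inC)

∈-encTree : ∀ a l t {p} → p ∈ encTree a l t → p ≡ (a , l) ⊎ p ∈ encKids a 1 (kids l t)
∈-encTree a l t mem with subst (_ ∈_) (encTree-kids a l t) mem
... | here p≡  = inj₁ p≡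
... | there in-kids = inj₂ in-kids

root-∈-encTree : ∀ a l t → (a , l) ∈ encTree a l t
root-∈-encTree a l (node _ _ _) = here refl

∈-encKids⁻ : ∀ a k zts {p} → p ∈ encKids a k zts →
             ∃₂ λ j zt → At k zts j zt × p ∈ encTree (a ++ [ j ]) (proj₁ zt) (proj₂ zt)
∈-encKids⁻ a k ((z , t) ∷ zts) mem with ∈-++⁻ (encTree (a ++ [ k ]) z t) mem
... | inj₁ in-t    = k , (z , t) , now , in-t
... | inj₂ in-rest = let (j , zt , at , in-t) = ∈-encKids⁻ a (suc k) zts in-rest
                     in j , zt , next at , in-t

∈-encKids⁺ : ∀ a {k zts j z t p} → At k zts j (z , t) → p ∈ encTree (a ++ [ j ]) z t → p ∈ encKids a k zts
∈-encKids⁺ a     now                     mem = ∈-++⁺ˡ mem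
∈-encKids⁺ a {k} (next {y = z , t} at) mem = ∈-++⁺ʳ (encTree (a ++ [ k ]) z t) (∈-encKids⁺ a at mem)

encTree-addresses : ∀ t a l {p} → p ∈ encTree a l t → ∃ λ w → proj₁ p ≡ a ++ w
encTree-addresses = tree-ind Addressed step
  where
    Addressed : Tree → Set
    Addressed t = ∀ a l {p} → p ∈ encTree a l t → ∃ λ w → proj₁ p ≡ a ++ w
    step : ∀ t → (∀ {l z u} → (z , u) ∈ kids l t → Addressed u) → Addressed t
    step t ih a l mem with ∈-encTree a l t mem
    ... | inj₁ refl = [] , sym (Listₚ.++-identityʳ a)
    ... | inj₂ in-kids with ∈-encKids⁻ a 1 (kids l t) in-kids
    ...   | j , (z , u) , at , in-u with ih (at-∈ at) (a ++ [ j ]) z in-u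
    ...     | w , p≡ = j ∷ w , trans p≡ (Listₚ.++-assoc a [ j ] w)

encKids-addresses : ∀ a k zts {p} → p ∈ encKids a k zts → ∃₂ λ j w → proj₁ p ≡ a ++ j ∷ w × k ≤ j
encKids-addresses a k zts mem with ∈-encKids⁻ a k zts mem
... | j , (z , u) , at , in-u with encTree-addresses u (a ++ [ j ]) z in-u
...   | w , p≡ = j , w , trans p≡ (Listₚ.++-assoc a [ j ] w) , proj₁ (at-range at)

∈-encKids-via : ∀ a k zts {j w y} → (a ++ j ∷ w , y) ∈ encKids a k zts →
                ∃ λ zt → At k zts j zt × (a ++ j ∷ w , y) ∈ encTree (a ++ [ j ]) (proj₁ zt) (proj₂ zt)
∈-encKids-via a k zts mem with ∈-encKids⁻ a k zts mem
... | j , (z , u) , at , in-u with encTree-addresses u (a ++ [ j ]) z in-u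
...   | w , p≡ with below-injective a (trans p≡ (Listₚ.++-assoc a [ j ] w))
...     | refl , _ = (z , u) , at , in-u

encTree-root-label : ∀ a l t {z} → (a , z) ∈ encTree a l t → z ≡ l
encTree-root-label a l t mem with ∈-encTree a l t mem
... | inj₁ p≡     = cong proj₂ p≡
... | inj₂ in-kids with encKids-addresses a 1 (kids l t) in-kids
...   | j , w , a≡ , _ = ⊥-elim (below≢ a j w (sym a≡))

encKids-unique : ∀ a k zts → (∀ {z u} → (z , u) ∈ zts → ∀ a′ → Unique (dom (encTree a′ z u))) →
                 Unique (dom (encKids a k zts))
encKids-unique a k []              _      = AllPairs.[]
encKids-unique a k ((z , u) ∷ zts) unique =
  subst Unique (sym (Listₚ.map-++ proj₁ (encTree (a ++ [ k ]) z u) _))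
        (Uniqueₚ.++⁺ (unique (here refl) (a ++ [ k ]))
                     (encKids-unique a (suc k) zts (λ mem → unique (there mem)))
                     disjoint)
  where
    disjoint : ∀ {v} → v ∈ dom (encTree (a ++ [ k ]) z u) × v ∈ dom (encKids a (suc k) zts) → ⊥
    disjoint (in-u , in-rest) with encTree-addresses u (a ++ [ k ]) z (proj₂ (dom-∈ in-u))
                                 | encKids-addresses a (suc k) zts (proj₂ (dom-∈ in-rest))
    ... | w , v≡ | j , w′ , v≡′ , k<j with below-injective a (trans (sym (trans v≡ (Listₚ.++-assoc a [ k ] w))) v≡′)
    ...   | refl , _ = ℕₚ.<-irrefl refl k<j

encTree-unique : ∀ t a l → Unique (dom (encTree a l t))
encTree-unique = tree-ind Distinct step
  where
    Distinct : Tree → Set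
    Distinct t = ∀ a l → Unique (dom (encTree a l t))
    step : ∀ t → (∀ {l z u} → (z , u) ∈ kids l t → Distinct u) → Distinct t
    step t ih a l = subst (λ E → Unique (dom E)) (sym (encTree-kids a l t))
      (All.tabulate root-not-below AllPairs.∷ encKids-unique a 1 (kids l t) (λ mem a′ → ih mem a′ _))
      where
        root-not-below : ∀ {v} → v ∈ dom (encKids a 1 (kids l t)) → a ≢ v
        root-not-below v∈ a≡v with encKids-addresses a 1 (kids l t) (proj₂ (dom-∈ v∈))
        ... | j , w , v≡ , _ = below≢ a j w (sym (trans a≡v v≡))

encTree-letters : ∀ t a l {p} → p ∈ encTree a l t → All (1 ≤_) a → All (1 ≤_) (proj₁ p)
encTree-letters = tree-ind Positive step
  where
    Positive : Tree → Set
    Positive t = ∀ a l {p} → p ∈ encTree a l t → All (1 ≤_) a → All (1 ≤_) (proj₁ p)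
    step : ∀ t → (∀ {l z u} → (z , u) ∈ kids l t → Positive u) → Positive t
    step t ih a l mem pos with ∈-encTree a l t mem
    ... | inj₁ refl = pos
    ... | inj₂ in-kids with ∈-encKids⁻ a 1 (kids l t) in-kids
    ...   | j , (z , u) , at , in-u = ih (at-∈ at) (a ++ [ j ]) z in-u (Allₚ.++⁺ pos (proj₁ (at-range at) ∷ []))

-- The subtree of E at address a, with root label l, is t: the encoding of t
-- lies in E, and contains every entry of E at or below a.
record Occurs (E : LForest) (a : Word) (l : ℤ) (t : Tree) : Set where
  field
    included   : ∀ {p} → p ∈ encTree a l t → p ∈ E
    exhaustive : ∀ {w y} → (a ++ w , y) ∈ E → (a ++ w , y) ∈ encTree a l t
open Occurs

occurs-kid : ∀ {E a k zts j z u} →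
  (∀ {p} → p ∈ encKids a k zts → p ∈ E) →
  (∀ {i w y} → (a ++ i ∷ w , y) ∈ E → (a ++ i ∷ w , y) ∈ encKids a k zts) →
  At k zts j (z , u) → Occurs E (a ++ [ j ]) z u
occurs-kid {E} {a} {k} {zts} {j} inc exh at = record
  { included   = λ mem → inc (∈-encKids⁺ a at mem)
  ; exhaustive = λ {w} {y} mem →
      let (zt , at′ , in-u) = ∈-encKids-via a k zts (exh (subst (λ v → (v , y) ∈ E) (Listₚ.++-assoc a [ j ] w) mem))
      in subst₂ (λ v zt → (v , y) ∈ encTree (a ++ [ j ]) (proj₁ zt) (proj₂ zt))
                (sym (Listₚ.++-assoc a [ j ] w)) (at-functional at′ at) in-u
  }

occurs-below : ∀ {E a l t i w y} → Occurs E a l t → (a ++ i ∷ w , y) ∈ E → (a ++ i ∷ w , y) ∈ encKids a 1 (kids l t)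
occurs-below {a = a} {l} {t} {i} {w} occ mem with ∈-encTree a l t (exhaustive occ mem)
... | inj₁ p≡     = ⊥-elim (below≢ a i w (cong proj₁ p≡))
... | inj₂ in-kids = in-kids

occurs-child : ∀ {E a l t j z u} → Occurs E a l t → At 1 (kids l t) j (z , u) → Occurs E (a ++ [ j ]) z u
occurs-child {a = a} {l} {t} occ =
  occurs-kid (λ mem → included occ (subst (_ ∈_) (sym (encTree-kids a l t)) (there mem))) (occurs-below occ)

occurs-kid-index : ∀ {E a l t j y} → Occurs E a l t → (a ++ [ j ] , y) ∈ E → ∃ λ u → At 1 (kids l t) j (y , u)
occurs-kid-index {a = a} {l} {t} {j} occ mem with ∈-encKids-via a 1 (kids l t) (occurs-below occ mem)
... | (z , u) , at , in-u with encTree-root-label (a ++ [ j ]) z u in-u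
...   | refl = u , at

locate : ∀ {E a l t} → Occurs E a l t → ∀ w {y} → (a ++ w , y) ∈ E → ∃ λ u → Occurs E (a ++ w) y u
locate {E} {a} {l} {t} occ [] {y} mem
  with encTree-root-label a l t (subst (λ v → (v , y) ∈ encTree a l t) (Listₚ.++-identityʳ a) (exhaustive occ mem))
... | refl = t , subst (λ v → Occurs E v l t) (sym (Listₚ.++-identityʳ a)) occ
locate {E} {a} {l} {t} occ (j ∷ w) {y} mem =
  let ((z , u) , at , _) = ∈-encKids-via a 1 (kids l t) (occurs-below occ mem)
      (u′ , occ′) = locate (occurs-child occ at) w (subst (λ v → (v , y) ∈ E) (sym (Listₚ.++-assoc a [ j ] w)) mem)
  in u′ , subst (λ v → Occurs E v y u′) (Listₚ.++-assoc a [ j ] w) occ′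

occurs-parent : ∀ {E a l t} → Occurs E a l t → ∀ w j {y} → ((a ++ w) ++ [ j ] , y) ∈ E → a ++ w ∈ dom E
occurs-parent {E} {a} {l} {t} occ []      j mem =
  subst (_∈ dom E) (sym (Listₚ.++-identityʳ a)) (∈-dom (included occ (root-∈-encTree a l t)))
occurs-parent {E} {a} {l} {t} occ (i ∷ w) j {y} mem =
  subst (_∈ dom E) (Listₚ.++-assoc a [ i ] w) (occurs-parent (occurs-child occ at) w j mem′)
  where
    via = ∈-encKids-via a 1 (kids l t)
            (occurs-below occ (subst (λ v → (v , y) ∈ E) (Listₚ.++-assoc a (i ∷ w) [ j ]) mem))
    at = proj₁ (proj₂ via)
    mem′ = subst (λ v → (v ++ [ j ] , y) ∈ E) (sym (Listₚ.++-assoc a [ i ] w)) mem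

-- Root i ≤ τ carries the i-th grove as its children (all labelled -1); the
-- last root τ+1 is a leaf.
rootKids : List Grove → Kids
rootKids []      = [ (+ 0 , leaf) ]
rootKids (S ∷ X) = (+ 0 , node S [] []) ∷ rootKids X

encForest : List Grove → LForest
encForest X = encKids [] 1 (rootKids X)

rootKids-length : ∀ X → length (rootKids X) ≡ suc (length X)
rootKids-length []      = refl
rootKids-length (_ ∷ X) = cong suc (rootKids-length X)

at-rootKids⁻ : ∀ {k X i z t} → At k (rootKids X) i (z , t) →
  z ≡ + 0 × ((∃ λ S → At k X i S × t ≡ node S [] []) ⊎ (i ≡ k + length X × t ≡ leaf))
at-rootKids⁻ {k} {[]}    now       = refl , inj₂ (sym (ℕₚ.+-identityʳ k) , refl)
at-rootKids⁻ {X = S ∷ X} now       = refl , inj₁ (S , now , refl)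
at-rootKids⁻ {k} {S ∷ X} (next at) with at-rootKids⁻ at
... | z≡ , inj₁ (S′ , at′ , t≡) = z≡ , inj₁ (S′ , next at′ , t≡)
... | z≡ , inj₂ (i≡ , t≡)        = z≡ , inj₂ (trans i≡ (sym (ℕₚ.+-suc k (length X))) , t≡)

at-rootKids⁺ : ∀ {k X i S} → At k X i S → At k (rootKids X) i (+ 0 , node S [] [])
at-rootKids⁺ now       = now
at-rootKids⁺ (next at) = next (at-rootKids⁺ at)

at-rootKids-last : ∀ X k → At k (rootKids X) (k + length X) (+ 0 , leaf)
at-rootKids-last []      k = subst (λ i → At k (rootKids []) i (+ 0 , leaf)) (sym (ℕₚ.+-identityʳ k)) now
at-rootKids-last (S ∷ X) k =
  next (subst (λ i → At (suc k) (rootKids X) i (+ 0 , leaf)) (sym (ℕₚ.+-suc k (length X)))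
              (at-rootKids-last X (suc k)))

-- One entry per node, plus one per root.
encForest-length : ∀ X k → length (encKids [] k (rootKids X)) ≡ grovesSize X + length X + 1
encForest-length []      k = Listₚ.length-++ (encTree [ k ] (+ 0) leaf) {[]}
encForest-length (S ∷ X) k = begin
    length (encTree [ k ] (+ 0) (node S [] []) ++ encKids [] (suc k) (rootKids X))
  ≡⟨ Listₚ.length-++ (encTree [ k ] (+ 0) (node S [] [])) ⟩
    length (encTree [ k ] (+ 0) (node S [] [])) + length (encKids [] (suc k) (rootKids X))
  ≡⟨ cong₂ _+_ (encTree-length [ k ] (+ 0) (node S [] [])) (encForest-length X (suc k)) ⟩
    suc (groveSize S + 0 + 0) + (grovesSize X + length X + 1)
  ≡⟨ arith (groveSize S) (grovesSize X) (length X) ⟩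
    groveSize S + grovesSize X + suc (length X) + 1 ∎
  where
    open ≡-Reasoning
    arith : ∀ s r n → suc (s + 0 + 0) + (r + n + 1) ≡ s + r + suc n + 1
    arith = solve-∀

encForest-unique : ∀ X → Unique (dom (encForest X))
encForest-unique X = encKids-unique [] 1 (rootKids X) (λ {z} {u} _ a → encTree-unique u a z)

root-kid-label : ∀ {k l S j z u} → At k (kids l (node S [] [])) j (z , u) → z ≡ below l
root-kid-label {l = l} {S} at with ∈-++⁻ (map (below l ,_) S) (at-∈ at)
... | inj₁ mem with ∈-map⁻ (below l ,_) mem
...   | _ , _ , refl = refl

leaf-no-kids : ∀ {l k j zt} → At k (kids l leaf) j zt → ⊥
leaf-no-kids ()

rootKids-kid-label : ∀ {k X i z t j y u} → At k (rootKids X) i (z , t) → At 1 (kids z t) j (y , u) → y ≡ -[1+ 0 ]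
rootKids-kid-label root kid with at-rootKids⁻ root
... | refl , inj₁ (_ , _ , refl) = root-kid-label {l = + 0} kid
... | refl , inj₂ (_ , refl)     = ⊥-elim (leaf-no-kids {l = + 0} kid)

module EncodedForest (X : List Grove) where

  private
    E = encForest X
    τ = length X

  occurs-root : ∀ {i z t} → At 1 (rootKids X) i (z , t) → Occurs E [ i ] z t
  occurs-root = occurs-kid (λ mem → mem) (λ mem → mem)

  entry-root : ∀ {v y} → (v , y) ∈ E →
    ∃₂ λ i w → v ≡ i ∷ w × ∃ λ zt → At 1 (rootKids X) i zt × (v , y) ∈ encTree [ i ] (proj₁ zt) (proj₂ zt)
  entry-root mem with encKids-addresses [] 1 (rootKids X) mem
  ... | i , w , refl , _ = i , w , refl , ∈-encKids-via [] 1 (rootKids X) mem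

  occurs-entry : ∀ {v y} → (v , y) ∈ E → ∃ λ t → Occurs E v y t
  occurs-entry mem with entry-root mem
  ... | i , w , refl , (z , t) , at , _ = locate (occurs-root at) w mem

  word : ∀ {v} → v ∈ dom E → IsWord v
  word v∈ with entry-root (proj₂ (dom-∈ v∈))
  ... | i , w , refl , (z , t) , at , in-t = (λ ()) , encTree-letters t [ i ] z in-t (proj₁ (at-range at) ∷ [])

  roots : ∀ u → (u ∈ dom E × length u ≡ 1) ⇔ (∃ λ i → 1 ≤ i × i ≤ suc τ × u ≡ [ i ])
  roots u = mk⇔ to from
    where
      to : u ∈ dom E × length u ≡ 1 → ∃ λ i → 1 ≤ i × i ≤ suc τ × u ≡ [ i ]
      to (u∈ , len) with entry-root (proj₂ (dom-∈ u∈))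
      ... | i , []    , refl , _ , at , _ =
        i , proj₁ (at-range at) , subst (i ≤_) (rootKids-length X) (ℕₚ.≤-pred (proj₂ (at-range at))) , refl
      ... | i , _ ∷ _ , refl , _ = ⊥-elim (ℕₚ.1+n≢0 (ℕₚ.suc-injective len))
      from : (∃ λ i → 1 ≤ i × i ≤ suc τ × u ≡ [ i ]) → u ∈ dom E × length u ≡ 1
      from (i , 1≤i , i≤ , refl) with at-exists 1 (rootKids X) i 1≤i (s≤s (subst (i ≤_) (sym (rootKids-length X)) i≤))
      ... | (z , t) , at = ∈-dom (∈-encKids⁺ [] at (root-∈-encTree [ i ] z t)) , refl

  parent-entry : ∀ {v y} → (v , y) ∈ E → 2 ≤ length v → pa v ∈ dom E
  parent-entry mem two≤ with entry-root mem
  ... | i , w , refl , (z , t) , at , _ with initLast w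
  ...   | []       = ⊥-elim (ℕₚ.<-irrefl refl two≤)
  ...   | w′ ∷ʳ′ j = subst (_∈ dom E) (sym (pa-∷ʳ (i ∷ w′) j)) (occurs-parent (occurs-root at) w′ j mem)

  parent : ∀ u → u ∈ dom E → 2 ≤ length u → pa u ∈ dom E
  parent u u∈ = parent-entry (proj₂ (dom-∈ u∈))

  children : ∀ u → u ∈ dom E → ∃ λ c → ∀ i → 1 ≤ i → (u ++ [ i ] ∈ dom E ⇔ i ≤ c)
  children u u∈ =
    let (z , mem) = dom-∈ u∈
        (t , occ) = occurs-entry mem
    in length (kids z t) , λ i 1≤i → mk⇔
      (λ ui∈ → ℕₚ.≤-pred (proj₂ (at-range (proj₂ (occurs-kid-index occ (proj₂ (dom-∈ ui∈)))))))
      (λ i≤ → let ((y , v) , at) = at-exists 1 (kids z t) i 1≤i (s≤s i≤)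
              in ∈-dom (included (occurs-child occ at) (root-∈-encTree _ y v)))

  lastRoot : ∀ i → 1 ≤ i → (suc τ ∷ [ i ]) ∉ dom E
  lastRoot i _ ui∈ =
    leaf-no-kids {l = + 0} (proj₂ (occurs-kid-index (occurs-root (at-rootKids-last X 1)) (proj₂ (dom-∈ ui∈))))

  label1 : ∀ u z → (u , z) ∈ E → length u ≡ 1 → z ≡ + 0
  label1 u z mem len with entry-root mem
  ... | i , []    , refl , (z′ , t) , at , in-t = trans (encTree-root-label [ i ] z′ t in-t) (proj₁ (at-rootKids⁻ at))
  ... | i , _ ∷ _ , refl , _ = ⊥-elim (ℕₚ.1+n≢0 (ℕₚ.suc-injective len))

  label2 : ∀ u z → (u , z) ∈ E → length u ≡ 2 → z ≡ -[1+ 0 ]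
  label2 u z mem len with entry-root mem
  ... | i , []          , refl , _ = ⊥-elim (ℕₚ.0≢1+n (ℕₚ.suc-injective len))
  ... | i , _ ∷ _ ∷ _   , refl , _ = ⊥-elim (ℕₚ.1+n≢0 (ℕₚ.suc-injective (ℕₚ.suc-injective len)))
  ... | i , j ∷ []      , refl , _ , at , _ =
    rootKids-kid-label at (proj₂ (occurs-kid-index (occurs-root at) mem))

  first : ∀ u z z₁ → (u , z) ∈ E → 2 ≤ length u → (u ++ [ 1 ] , z₁) ∈ E → z ℤ.- ℤ.1ℤ ℤ.≤ z₁
  first u z z₁ mem _ mem₁ =
    let (t , occ) = occurs-entry mem
    in chain-first proj₁ (kids-chain z t) (proj₂ (occurs-kid-index occ mem₁))

  mono : ∀ u i z₁ z₂ → 2 ≤ length u → 1 ≤ i → (u ++ [ i ] , z₁) ∈ E → (u ++ [ suc i ] , z₂) ∈ E → z₁ ℤ.≤ z₂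
  mono u i z₁ z₂ two≤ _ mem₁ mem₂ =
    let u∈ = subst (_∈ dom E) (pa-∷ʳ u i) (parent-entry mem₁ (ℕₚ.≤-trans two≤ (longer u i)))
        (z , mem) = dom-∈ u∈
        (t , occ) = occurs-entry mem
    in chain-step proj₁ (linked-tail (kids-chain z t))
                  (proj₂ (occurs-kid-index occ mem₁)) (proj₂ (occurs-kid-index occ mem₂))
    where
      longer : ∀ (u : Word) i → length u ≤ length (u ++ [ i ])
      longer u i = subst (length u ≤_) (sym (Listₚ.length-++ u)) (ℕₚ.m≤m+n (length u) 1)

  last : ∀ u i z zᵢ → (u , z) ∈ E → 2 ≤ length u → 1 ≤ i → (u ++ [ i ] , zᵢ) ∈ E →
         (u ++ [ suc i ]) ∉ dom E → zᵢ ℤ.≤ z ℤ.+ ℤ.1ℤ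
  last u i z zᵢ mem _ _ memᵢ absent =
    let (t , occ) = occurs-entry mem
    in chain-last proj₁ (linked-tail (kids-chain z t)) (proj₂ (occurs-kid-index occ memᵢ))
         λ { (y , v) at → absent (∈-dom (included (occurs-child occ at) (root-∈-encTree _ y v))) }

  wellLabeled : IsWLF (grovesSize X) τ E
  wellLabeled = record
    { forest = record
      { unique   = encForest-unique X
      ; words    = All.tabulate word
      ; roots    = roots
      ; parent   = parent
      ; children = children
      ; lastRoot = lastRoot
      }
    ; size   = encForest-length X 1
    ; label1 = label1
    ; label2 = label2
    ; first  = first
    ; mono   = mono
    ; last   = last
    }

Describes : (Word → Maybe ℤ) → LForest → Set
Describes lab E = ∀ {v z} → lab v ≡ just z ⇔ (v , z) ∈ E

labelAt : LForest → Word → Maybe ℤ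
labelAt []            v = nothing
labelAt ((u , z) ∷ L) v with Listₚ.≡-dec ℕₚ._≟_ u v
... | yes _ = just z
... | no _  = labelAt L v

labelAt-sound : ∀ L {v z} → labelAt L v ≡ just z → (v , z) ∈ L
labelAt-sound ((u , y) ∷ L) {v} found with Listₚ.≡-dec ℕₚ._≟_ u v
... | yes refl = subst (λ z → (v , z) ∈ _) (Maybeₚ.just-injective found) (here refl)
... | no _     = there (labelAt-sound L found)

labelAt-defined : ∀ L {v z} → (v , z) ∈ L → ∃ λ z′ → labelAt L v ≡ just z′
labelAt-defined ((u , y) ∷ L) {v} mem with Listₚ.≡-dec ℕₚ._≟_ u v | mem
... | yes _   | _          = y , refl
... | no u≢v | here refl  = ⊥-elim (u≢v refl)
... | no _   | there mem′ = labelAt-defined L mem′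

not-just : ∀ {A : Set} {m : Maybe A} → (∀ {x} → m ≡ just x → ⊥) → m ≡ nothing
not-just {m = nothing} _       = refl
not-just {m = just _}  no-just = ⊥-elim (no-just refl)

unique-keys : ∀ {A B : Set} {xs : List (A × B)} → Unique (map proj₁ xs) →
              ∀ {x y y′} → (x , y) ∈ xs → (x , y′) ∈ xs → y ≡ y′
unique-keys (_ AllPairs.∷ _)     (here refl) (here refl) = refl
unique-keys (fresh AllPairs.∷ _) (here refl) (there mem) = ⊥-elim (All.lookup fresh (∈-map⁺ proj₁ mem) refl)
unique-keys (fresh AllPairs.∷ _) (there mem) (here refl) = ⊥-elim (All.lookup fresh (∈-map⁺ proj₁ mem) refl)
unique-keys (_ AllPairs.∷ keys)  (there mem) (there mem′) = unique-keys keys mem mem′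

describes-labelAt : ∀ L E → Unique (dom E) → (∀ {p} → p ∈ L ⇔ p ∈ E) → Describes (labelAt L) E
describes-labelAt L E keys same = mk⇔
  (λ found → Equivalence.to same (labelAt-sound L found))
  (λ mem → let (z′ , found) = labelAt-defined L (Equivalence.from same mem)
           in trans found (cong just (unique-keys keys (Equivalence.to same (labelAt-sound L found)) mem)))

Bounded : ℕ → LForest → Set
Bounded N E = ∀ {v z} → (v , z) ∈ E → length v < N × All (_< N) v

weight : Word × ℤ → ℕ
weight (v , _) = max (length v) v

bound : LForest → ℕ
bound L = suc (max 0 (map weight L))

bounded : ∀ L → Bounded (bound L) L
bounded L {v} {z} mem =
  s≤s (ℕₚ.≤-trans (⊥≤max (length v) v) weight≤) , All.map (λ x≤ → s≤s (ℕₚ.≤-trans x≤ weight≤)) (xs≤max (length v) v)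
  where
    weight≤ : weight (v , z) ≤ max 0 (map weight L)
    weight≤ = All.lookup (xs≤max 0 (map weight L)) (∈-map⁺ weight mem)

belowGroup : Tree → Grove
belowGroup (node b _ _) = b

-- N bounds the number of children of a node, and the depth of the forest.
module Decode (lab : Word → Maybe ℤ) (N : ℕ) where

  mutual
    rebuild : ℕ → Word → ℤ → Tree
    rebuild zero    a l = leaf
    rebuild (suc d) a l = regroup l (readKids d N a 1)

    readKids : ℕ → ℕ → Word → ℕ → Kids
    readKids d zero    a k = []
    readKids d (suc n) a k = readKid d n a k (lab (a ++ [ k ]))

    readKid : ℕ → ℕ → Word → ℕ → Maybe ℤ → Kids
    readKid d n a k nothing  = []
    readKid d n a k (just z) = (z , rebuild d (a ++ [ k ]) z) ∷ readKids d n a (suc k)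

  readRoots : ℕ → ℕ → List Grove
  readRoots zero    k = []
  readRoots (suc τ) k = belowGroup (rebuild N [ k ] (+ 0)) ∷ readRoots τ (suc k)

  readKids-at : ∀ d n a k {j z t} → At k (readKids d n a k) j (z , t) →
                lab (a ++ [ j ]) ≡ just z × t ≡ rebuild d (a ++ [ j ]) z
  readKids-at d (suc n) a k at with lab (a ++ [ k ]) in found | at
  ... | just z | now      = found , refl
  ... | just z | next at′ = readKids-at d n a (suc k) at′

  readKids-finds : ∀ d n a k {j z} → k ≤ j → j < k + n → (∀ i → k ≤ i → i < j → lab (a ++ [ i ]) ≢ nothing) →
                   lab (a ++ [ j ]) ≡ just z → At k (readKids d n a k) j (z , rebuild d (a ++ [ j ]) z)
  readKids-finds d zero    a k k≤j j< _ _ =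
    ⊥-elim (ℕₚ.<-irrefl refl (ℕₚ.≤-<-trans k≤j (subst (_ <_) (ℕₚ.+-identityʳ k) j<)))
  readKids-finds d (suc n) a k {j} k≤j j< present found with ℕₚ.m≤n⇒m<n∨m≡n k≤j
  ... | inj₂ refl rewrite found = now
  ... | inj₁ k<j with lab (a ++ [ k ]) in here-found
  ...   | nothing = ⊥-elim (present k ℕₚ.≤-refl k<j here-found)
  ...   | just _  = next (readKids-finds d n a (suc k) k<j (subst (j <_) (ℕₚ.+-suc k n) j<)
                            (λ i k<i i<j → present i (ℕₚ.<⇒≤ k<i) i<j) found)

  readKids-exact : ∀ d n a k zts →
    (∀ {j z t} → At k zts j (z , t) → lab (a ++ [ j ]) ≡ just z × rebuild d (a ++ [ j ]) z ≡ t) →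
    lab (a ++ [ k + length zts ]) ≡ nothing → length zts < n → readKids d n a k ≡ zts
  readKids-exact d (suc n) a k [] _ stop _
    rewrite subst (λ i → lab (a ++ [ i ]) ≡ nothing) (ℕₚ.+-identityʳ k) stop = refl
  readKids-exact d (suc n) a k ((z , t) ∷ zts) spec stop (s≤s short)
    rewrite proj₁ (spec now) =
      cong₂ _∷_ (cong (z ,_) (proj₂ (spec now)))
                (readKids-exact d n a (suc k) zts (λ at → spec (next at))
                                (subst (λ i → lab (a ++ [ i ]) ≡ nothing) (ℕₚ.+-suc k (length zts)) stop) short)

  readKids-chain : ∀ d n a k {lo hi} →
    (∀ {z} → lab (a ++ [ k ]) ≡ just z → lo ℤ.≤ z) →
    (lab (a ++ [ k ]) ≡ nothing → lo ℤ.≤ hi) →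
    (∀ {i z z′} → k ≤ i → lab (a ++ [ i ]) ≡ just z → lab (a ++ [ suc i ]) ≡ just z′ → z ℤ.≤ z′) →
    (∀ {i z} → k ≤ i → lab (a ++ [ i ]) ≡ just z → lab (a ++ [ suc i ]) ≡ nothing → z ℤ.≤ hi) →
    (∀ {i} → k + n ≤ i → lab (a ++ [ i ]) ≡ nothing) →
    Linked ℤ._≤_ (lo ∷ labels (readKids d n a k) ++ [ hi ])
  readKids-chain d zero    a k _ ends _ _ beyond = ends (beyond (ℕₚ.≤-reflexive (ℕₚ.+-identityʳ k))) ∷ [-]
  readKids-chain d (suc n) a k starts ends steps lasts beyond with lab (a ++ [ k ]) in found
  ... | nothing = ends refl ∷ [-]
  ... | just z  = starts refl ∷ readKids-chain d n a (suc k)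
                    (steps ℕₚ.≤-refl found) (lasts ℕₚ.≤-refl found)
                    (λ k<i → steps (ℕₚ.<⇒≤ k<i)) (λ k<i → lasts (ℕₚ.<⇒≤ k<i))
                    (λ {i} le → beyond (subst (_≤ i) (sym (ℕₚ.+-suc k n)) le))

  readRoots-length : ∀ τ k → length (readRoots τ k) ≡ τ
  readRoots-length zero    k = refl
  readRoots-length (suc τ) k = cong suc (readRoots-length τ (suc k))

  at-readRoots : ∀ τ k {i S} → At k (readRoots τ k) i S → S ≡ belowGroup (rebuild N [ i ] (+ 0))
  at-readRoots (suc τ) k now       = refl
  at-readRoots (suc τ) k (next at) = at-readRoots τ (suc k) at

  readRoots-exact : ∀ X k → (∀ {i S} → At k X i S → belowGroup (rebuild N [ i ] (+ 0)) ≡ S) →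
                    readRoots (length X) k ≡ X
  readRoots-exact []      k _    = refl
  readRoots-exact (S ∷ X) k spec = cong₂ _∷_ (spec now) (readRoots-exact X (suc k) (λ at → spec (next at)))

fuel-child : ∀ {N d} (a : Word) j → N ≤ length a + suc d → N ≤ length (a ++ [ j ]) + d
fuel-child {N} a j = subst (N ≤_) (trans (ℕₚ.+-suc (length a) _) (cong (_+ _) (sym (length-∷ʳ a j))))

no-fuel : ∀ {N} (a : Word) → length a < N → N ≤ length a + 0 → ⊥
no-fuel a short fuel = ℕₚ.<-irrefl refl (ℕₚ.<-≤-trans short (subst (_ ≤_) (ℕₚ.+-identityʳ (length a)) fuel))

module DecodeEncoded (lab : Word → Maybe ℤ) (N : ℕ) (X : List Grove)
                     (describes : Describes lab (encForest X)) (bounds : Bounded N (encForest X)) where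

  open Decode lab N

  private
    E = encForest X

  rebuild-occurs : ∀ d {a l t} → Occurs E a l t → N ≤ length a + d → rebuild d a l ≡ t
  rebuild-occurs zero    {a} {l} {t} occ fuel =
    ⊥-elim (no-fuel a (proj₁ (bounds (included occ (root-∈-encTree a l t)))) fuel)
  rebuild-occurs (suc d) {a} {l} {t} occ fuel = begin
      regroup l (readKids d N a 1) ≡⟨ cong (regroup l) (readKids-exact d N a 1 (kids l t) spec stop few) ⟩
      regroup l (kids l t)         ≡⟨ regroup-kids l t ⟩
      t                            ∎
    where
      open ≡-Reasoning
      spec : ∀ {j z u} → At 1 (kids l t) j (z , u) → lab (a ++ [ j ]) ≡ just z × rebuild d (a ++ [ j ]) z ≡ u
      spec {j} {z} {u} at = let occ′ = occurs-child occ at in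
        Equivalence.from describes (included occ′ (root-∈-encTree (a ++ [ j ]) z u)) ,
        rebuild-occurs d occ′ (fuel-child a j fuel)

      stop : lab (a ++ [ 1 + length (kids l t) ]) ≡ nothing
      stop with lab (a ++ [ 1 + length (kids l t) ]) in found
      ... | nothing = refl
      ... | just _  = ⊥-elim (ℕₚ.<-irrefl refl (proj₂ (at-range (proj₂
                        (occurs-kid-index occ (Equivalence.to describes found))))))

      -- The number of children is a letter of an address, hence below N.
      few : length (kids l t) < N
      few with length (kids l t) in len
      ... | zero  = ℕₚ.≤-trans (s≤s z≤n) (proj₁ (bounds (included occ (root-∈-encTree a l t))))
      ... | suc c with at-exists 1 (kids l t) (suc c) (s≤s z≤n) (subst (λ n → suc c < 1 + n) (sym len) ℕₚ.≤-refl)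
      ...   | (y , u) , at =
        All.head (Allₚ.++⁻ʳ a (proj₂ (bounds (included (occurs-child occ at) (root-∈-encTree _ y u)))))

  readRoots-encForest : readRoots (length X) 1 ≡ X
  readRoots-encForest = readRoots-exact X 1 λ at →
    cong belowGroup (rebuild-occurs N (EncodedForest.occurs-root X (at-rootKids⁺ at)) (ℕₚ.n≤1+n N))

module DecodeWLF {ρ τ : ℕ} {L : LForest} (W : IsWLF ρ τ L) where

  open IsWLF W
  open IsForest forest

  private
    lab = labelAt L
    N   = bound L

  open Decode lab N

  describes : Describes lab L
  describes = describes-labelAt L L unique (mk⇔ (λ mem → mem) (λ mem → mem))

  present : ∀ {v} → v ∈ dom L → lab v ≢ nothing
  present v∈ none with trans (sym (Equivalence.from describes (proj₂ (dom-∈ v∈)))) none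
  ... | ()

  same-label : ∀ {v z z′} → (v , z) ∈ L → (v , z′) ∈ L → z ≡ z′
  same-label = unique-keys unique

  index-positive : ∀ {a i} → a ++ [ i ] ∈ dom L → 1 ≤ i
  index-positive {a} ai∈ = All.head (Allₚ.++⁻ʳ a (proj₂ (All.lookup words ai∈)))

  index-bounded : ∀ {a i z} → (a ++ [ i ] , z) ∈ L → i < N
  index-bounded {a} mem = All.head (Allₚ.++⁻ʳ a (proj₂ (bounded L mem)))

  prefix-∈ : ∀ a w → a ++ w ∈ dom L → 1 ≤ length a → a ∈ dom L
  prefix-∈ a []      a∈  _  = subst (_∈ dom L) (Listₚ.++-identityʳ a) a∈
  prefix-∈ a (j ∷ w) aw∈ 1≤ =
    subst (_∈ dom L) (pa-∷ʳ a j) (parent (a ++ [ j ]) aj∈ (subst (2 ≤_) (sym (length-∷ʳ a j)) (s≤s 1≤)))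
    where
      aj∈ = prefix-∈ (a ++ [ j ]) w (subst (_∈ dom L) (sym (Listₚ.++-assoc a [ j ] w)) aw∈)
                     (subst (1 ≤_) (sym (length-∷ʳ a j)) (s≤s z≤n))

  elder-∈ : ∀ {a j i} → a ∈ dom L → a ++ [ j ] ∈ dom L → 1 ≤ i → i ≤ j → a ++ [ i ] ∈ dom L
  elder-∈ {a} {j} {i} a∈ aj∈ 1≤i i≤j =
    let (c , numbered) = children a a∈
    in Equivalence.from (numbered i 1≤i) (ℕₚ.≤-trans i≤j (Equivalence.to (numbered j (ℕₚ.≤-trans 1≤i i≤j)) aj∈))

  record ChainAt (a : Word) (l : ℤ) : Set where
    field
      starts : ∀ {z} → (a ++ [ 1 ] , z) ∈ L → below l ℤ.≤ z
      steps  : ∀ {i z z′} → 1 ≤ i → (a ++ [ i ] , z) ∈ L → (a ++ [ suc i ] , z′) ∈ L → z ℤ.≤ z′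
      ends   : ∀ {i z} → (a ++ [ i ] , z) ∈ L → a ++ [ suc i ] ∉ dom L → z ℤ.≤ above l

  -- It holds at the deeper nodes by definition, and at the roots because their
  -- children are all labelled -1.
  chainAt : ∀ {a l} → (a , l) ∈ L → 1 ≤ length a → ChainAt a l
  chainAt {a} {l} mem 1≤ with ℕₚ.m≤n⇒m<n∨m≡n 1≤
  ... | inj₁ 2≤ = record
    { starts = first a l _ mem 2≤
    ; steps  = mono a _ _ _ 2≤
    ; ends   = λ memᵢ absent → last a _ l _ mem 2≤ (index-positive (∈-dom memᵢ)) memᵢ absent
    }
  ... | inj₂ 1≡ with label1 a l mem (sym 1≡)
  ...   | refl = record
    { starts = λ m → ℤₚ.≤-reflexive (sym (kid-label m))
    ; steps  = λ _ m m′ → ℤₚ.≤-reflexive (trans (kid-label m) (sym (kid-label m′)))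
    ; ends   = λ m _ → subst (ℤ._≤ above (+ 0)) (sym (kid-label m)) (below≤above (+ 0))
    }
    where
      kid-label : ∀ {i z} → (a ++ [ i ] , z) ∈ L → z ≡ -[1+ 0 ]
      kid-label {i} m = label2 _ _ m (trans (length-∷ʳ a i) (cong suc (sym 1≡)))

  read-chain : ∀ d {a l} → ChainAt a l → LabelChain l (readKids d N a 1)
  read-chain d {a} {l} c = readKids-chain d N a 1
    (λ found → starts (Equivalence.to describes found))
    (λ _ → below≤above l)
    (λ 1≤i found found′ → steps 1≤i (Equivalence.to describes found) (Equivalence.to describes found′))
    (λ _ found none → ends (Equivalence.to describes found) (λ v∈ → present v∈ none))
    (λ N<i → not-just (λ found → ℕₚ.<-asym (index-bounded (Equivalence.to describes found)) N<i))
    where open ChainAt c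

  read-child : ∀ d {a l j z} → (a , l) ∈ L → (a ++ [ j ] , z) ∈ L →
               At 1 (readKids d N a 1) j (z , rebuild d (a ++ [ j ]) z)
  read-child d {a} mem mj =
    readKids-finds d N a 1 (index-positive (∈-dom mj)) (ℕₚ.m<n⇒m<1+n (index-bounded mj))
      (λ i 1≤i i<j → present (elder-∈ (∈-dom mem) (∈-dom mj) 1≤i (ℕₚ.<⇒≤ i<j)))
      (Equivalence.from describes mj)

  rebuild-occurs : ∀ d {a l} → (a , l) ∈ L → 1 ≤ length a → N ≤ length a + d → Occurs L a l (rebuild d a l)
  rebuild-occurs zero    {a} mem _ fuel = ⊥-elim (no-fuel a (proj₁ (bounded L mem)) fuel)
  rebuild-occurs (suc d) {a} {l} mem 1≤ fuel = record { included = included′ ; exhaustive = exhaustive′ }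
    where
      s = readKids d N a 1

      shape : encTree a l (regroup l s) ≡ (a , l) ∷ encKids a 1 s
      shape = trans (encTree-kids a l (regroup l s))
                    (cong (λ zts → (a , l) ∷ encKids a 1 zts) (kids-regroup l s (read-chain d (chainAt mem 1≤))))

      child : ∀ {j z u} → At 1 s j (z , u) → Occurs L (a ++ [ j ]) z u
      child {j} at with readKids-at d N a 1 at
      ... | found , refl = rebuild-occurs d (Equivalence.to describes found)
                             (subst (1 ≤_) (sym (length-∷ʳ a j)) (s≤s z≤n)) (fuel-child a j fuel)

      included′ : ∀ {p} → p ∈ encTree a l (regroup l s) → p ∈ L
      included′ mem′ with subst (_ ∈_) shape mem′
      ... | here refl     = mem
      ... | there in-kids = let (_ , _ , at , in-u) = ∈-encKids⁻ a 1 s in-kids in included (child at) in-u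

      exhaustive′ : ∀ {w y} → (a ++ w , y) ∈ L → (a ++ w , y) ∈ encTree a l (regroup l s)
      exhaustive′ {[]} {y} m =
        subst (λ v → (v , y) ∈ encTree a l (regroup l s)) (sym (Listₚ.++-identityʳ a))
              (subst (λ z → (a , z) ∈ encTree a l (regroup l s))
                     (same-label mem (subst (λ v → (v , y) ∈ L) (Listₚ.++-identityʳ a) m))
                     (root-∈-encTree a l (regroup l s)))
      exhaustive′ {j ∷ w} {y} m =
        subst (_ ∈_) (sym shape) (there (∈-encKids⁺ a at
          (subst (λ v → (v , y) ∈ encTree (a ++ [ j ]) z (rebuild d (a ++ [ j ]) z)) (Listₚ.++-assoc a [ j ] w)
                 (exhaustive (child at) m′))))
        where
          m′ : ((a ++ [ j ]) ++ w , y) ∈ L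
          m′ = subst (λ v → (v , y) ∈ L) (sym (Listₚ.++-assoc a [ j ] w)) m
          aj∈ = prefix-∈ (a ++ [ j ]) w (∈-dom m′) (subst (1 ≤_) (sym (length-∷ʳ a j)) (s≤s z≤n))
          z = proj₁ (dom-∈ aj∈)
          at : At 1 s j (z , rebuild d (a ++ [ j ]) z)
          at = read-child d mem (proj₂ (dom-∈ aj∈))

  root-∈ : ∀ {i} → 1 ≤ i → i ≤ suc τ → ([ i ] , + 0) ∈ L
  root-∈ {i} 1≤i i≤ =
    let (z , m) = dom-∈ (proj₁ (Equivalence.from (roots [ i ]) (i , 1≤i , i≤ , refl)))
    in subst (λ z → ([ i ] , z) ∈ L) (label1 [ i ] z m refl) m

  root-shape : ∀ i → rebuild N [ i ] (+ 0) ≡ node (belowGroup (rebuild N [ i ] (+ 0))) [] []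
  root-shape i = trans grouped (cong (λ T → node (belowGroup T) [] []) (sym grouped))
    where
      s = readKids (max 0 (map weight L)) N [ i ] 1
      grouped : rebuild N [ i ] (+ 0) ≡ node (map proj₂ s) [] []
      grouped = regroup-belows (+ 0) s (All.tabulate λ z∈ →
        let (_ , at) = ∈-at 1 z∈
        in label2 _ _ (Equivalence.to describes (proj₁ (readKids-at _ N [ i ] 1 at))) refl)

  X₀ : List Grove
  X₀ = readRoots τ 1

  X₀-length : length X₀ ≡ τ
  X₀-length = readRoots-length τ 1

  root-occurs : ∀ {i} → 1 ≤ i → i ≤ τ → Occurs L [ i ] (+ 0) (node (belowGroup (rebuild N [ i ] (+ 0))) [] [])
  root-occurs {i} 1≤i i≤τ = subst (Occurs L [ i ] (+ 0)) (root-shape i)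
    (rebuild-occurs N (root-∈ 1≤i (ℕₚ.m≤n⇒m≤1+n i≤τ)) (s≤s z≤n) (ℕₚ.n≤1+n N))

  at-root : ∀ {i} → 1 ≤ i → i ≤ τ → At 1 (rootKids X₀) i (+ 0 , node (belowGroup (rebuild N [ i ] (+ 0))) [] [])
  at-root {i} 1≤i i≤τ =
    let (S , at) = at-exists 1 X₀ i 1≤i (s≤s (subst (i ≤_) (sym X₀-length) i≤τ))
    in subst (λ S → At 1 (rootKids X₀) i (+ 0 , node S [] [])) (at-readRoots τ 1 at) (at-rootKids⁺ at)

  at-last-root : At 1 (rootKids X₀) (suc τ) (+ 0 , leaf)
  at-last-root = subst (λ n → At 1 (rootKids X₀) (suc n) (+ 0 , leaf)) X₀-length (at-rootKids-last X₀ 1)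

  complete : ∀ {v y} → (v , y) ∈ L → (v , y) ∈ encForest X₀
  complete {[]}        mem = ⊥-elim (proj₁ (All.lookup words (∈-dom mem)) refl)
  complete {i ∷ w} {y} mem with Equivalence.to (roots [ i ]) (prefix-∈ [ i ] w (∈-dom mem) (s≤s z≤n) , refl)
  ... | _ , 1≤i , i≤ , refl with ℕₚ.m≤n⇒m<n∨m≡n i≤
  ...   | inj₁ i<    = ∈-encKids⁺ [] (at-root 1≤i (ℕₚ.≤-pred i<)) (exhaustive (root-occurs 1≤i (ℕₚ.≤-pred i<)) mem)
  ...   | inj₂ refl = last-root w mem
    where
      -- the last root has no children
      last-root : ∀ w {y} → (suc τ ∷ w , y) ∈ L → (suc τ ∷ w , y) ∈ encForest X₀
      last-root []      m = ∈-encKids⁺ [] at-last-root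
        (subst (λ z → ([ suc τ ] , z) ∈ encTree [ suc τ ] (+ 0) leaf) (sym (label1 _ _ m refl)) (here refl))
      last-root (j ∷ w) m =
        let mj = prefix-∈ (suc τ ∷ [ j ]) w (∈-dom m) (s≤s z≤n)
        in ⊥-elim (lastRoot j (index-positive {a = [ suc τ ]} mj) mj)

  sound : ∀ {p} → p ∈ encForest X₀ → p ∈ L
  sound mem with ∈-encKids⁻ [] 1 (rootKids X₀) mem
  ... | i , _ , at , in-t with at-rootKids⁻ at
  ...   | refl , inj₁ (S , atS , refl) =
    included (root-occurs 1≤i i≤τ) (subst (λ S → _ ∈ encTree [ i ] (+ 0) (node S [] [])) (at-readRoots τ 1 atS) in-t)
    where
      1≤i = proj₁ (at-range atS)
      i≤τ = subst (i ≤_) X₀-length (ℕₚ.≤-pred (proj₂ (at-range atS)))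
  ...   | refl , inj₂ (refl , refl) with in-t
  ...     | here refl = root-∈ (s≤s z≤n) (ℕₚ.≤-reflexive (cong suc X₀-length))

  perm : L ↭ encForest X₀
  perm = ∼bag⇒↭ (unique∧set⇒bag (Uniqueₚ.map⁻ unique) (Uniqueₚ.map⁻ (encForest-unique X₀)) (mk⇔ complete sound))

  X₀-size : grovesSize X₀ ≡ ρ
  X₀-size = ℕₚ.+-cancelʳ-≡ τ _ _ (ℕₚ.+-cancelʳ-≡ 1 _ _ (begin
      grovesSize X₀ + τ + 1          ≡⟨ cong (λ n → grovesSize X₀ + n + 1) (sym X₀-length) ⟩
      grovesSize X₀ + length X₀ + 1  ≡⟨ sym (encForest-length X₀ 1) ⟩
      length (encForest X₀)          ≡⟨ sym (Permₚ.↭-length perm) ⟩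
      length L                       ≡⟨ size ⟩
      ρ + τ + 1                      ∎))
    where open ≡-Reasoning

decodeForest : ℕ → LForest → List Grove
decodeForest τ L = Decode.readRoots (labelAt L) (bound L) τ 1

decodeForest-encForest : ∀ X L → (∀ {p} → p ∈ L ⇔ p ∈ encForest X) → decodeForest (length X) L ≡ X
decodeForest-encForest X L same = DecodeEncoded.readRoots-encForest (labelAt L) (bound L) X
  (describes-labelAt L (encForest X) (encForest-unique X) same)
  (λ mem → bounded L (Equivalence.from same mem))

decodeForest-↭ : ∀ {τ X L} → length X ≡ τ → L ↭ encForest X → decodeForest τ L ≡ X
decodeForest-↭ {X = X} {L} refl L↭ =
  decodeForest-encForest X L (mk⇔ (Permₚ.∈-resp-↭ L↭) (Permₚ.∈-resp-↭ (↭-sym L↭)))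

decodeForest-wlf : ∀ {ρ τ L} → IsWLF ρ τ L →
  L ↭ encForest (decodeForest τ L) × length (decodeForest τ L) ≡ τ × grovesSize (decodeForest τ L) ≡ ρ
decodeForest-wlf W = perm , X₀-length , X₀-size
  where open DecodeWLF W

decodeForest-respects : ∀ {ρ τ L L′} → IsWLF ρ τ L → L ↭ L′ → decodeForest τ L′ ≡ decodeForest τ L
decodeForest-respects W L↭L′ =
  let (perm , len , _) = decodeForest-wlf W in decodeForest-↭ len (↭-trans (↭-sym L↭L′) perm)

decodeForest-injective : ∀ {ρ τ L L′} → IsWLF ρ τ L → IsWLF ρ τ L′ →
                         decodeForest τ L ≡ decodeForest τ L′ → L ↭ L′
decodeForest-injective W W′ same =
  ↭-trans (proj₁ (decodeForest-wlf W))
          (↭-trans (↭-reflexive (cong encForest same)) (↭-sym (proj₁ (decodeForest-wlf W′))))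

decode-parameters : ∀ {ρ τ} w → InDInv (3 * ρ + τ) ρ w → grovesSize (decode w) ≡ ρ × length (decode w) ≡ τ
decode-parameters {ρ} {τ} w (dominated , zeros , ones) = size≡ , ℕₚ.+-cancelˡ-≡ (3 * ρ) _ _ (begin
    3 * ρ + length X            ≡⟨ cong (λ s → 3 * s + length X) (sym size≡) ⟩
    3 * grovesSize X + length X ≡⟨ sym (zeros-codeGroves X) ⟩
    count0 (codeGroves X)       ≡⟨ cong count0 code≡ ⟩
    count0 w                    ≡⟨ sym (count-reverse _ w) ⟩
    count0 (reverse w)          ≡⟨ zeros ⟩
    3 * ρ + τ                   ∎)
  where
    open ≡-Reasoning
    X = decode w
    code≡ = decode-correct w dominated
    size≡ : grovesSize X ≡ ρ
    size≡ = trans (sym (ones-codeGroves X)) (trans (cong count1 code≡) (trans (sym (count-reverse _ w)) ones))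

decode-wlf : ∀ {ρ τ} w → InDInv (3 * ρ + τ) ρ w → IsWLF ρ τ (encForest (decode w))
decode-wlf w w∈ = subst₂ (λ r t → IsWLF r t (encForest (decode w))) (proj₁ (decode-parameters w w∈))
                         (proj₂ (decode-parameters w w∈)) (EncodedForest.wellLabeled (decode w))

-- A forest is sent to the code of its groves; this respects permutations, is
-- injective because codes determine groves, and is onto because a word is the
-- code of the groves of the encoding of its decoding.
lemma11 : (ρ τ : ℕ) → 1 ≤ τ → Bijection (WLF-setoid ρ τ) (DInv-setoid (3 * ρ + τ) ρ)
lemma11 ρ τ _ = record
  { to        = to
  ; cong      = λ {F} {F′} F↭F′ → cong codeGroves (sym (decodeForest-respects {L′ = proj₁ F′} (proj₂ F) F↭F′))
  ; bijective = (λ {F} {F′} same-code →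
                   decodeForest-injective (proj₂ F) (proj₂ F′) (codeGroves-injective _ _ same-code))
              , λ { (w , w∈) → (encForest (decode w) , decode-wlf w w∈) , λ {F} F↭ →
                  trans (cong codeGroves
                           (decodeForest-↭ {X = decode w} {proj₁ F} (proj₂ (decode-parameters w w∈)) F↭))
                        (decode-correct w (proj₁ w∈)) }
  }
  where
    to : Σ LForest (IsWLF ρ τ) → Σ (List Bool) (InDInv (3 * ρ + τ) ρ)
    to (L , W) =
      let X = decodeForest τ L
          (_ , length≡ , size≡) = decodeForest-wlf W
      in codeGroves X , subst₂ (λ s n → InDInv (3 * s + n) s (codeGroves X)) size≡ length≡ (codeGroves-inDInv X)
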